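{- For all formulas $\phi,\psi$ of $\mathcal{L}(W)$, the formula $W\phi\to W(\neg W\psi\land\phi)$ is a theorem of $\mathbf{K5^W}$.
   Context: Fix a nonempty set $\mathbf{P}$ of propositional variables. $\mathcal{L}(W)$: $\phi::=p\mid\neg\phi\mid(\phi\land\phi)\mid W\phi$ ($p\in\mathbf{P}$), other connectives as usual. The system $\mathbf{K^W}$ has: A0 all instances of propositional tautologies; A1 $W\phi\to\neg\phi$; A2 $W\phi\land W\psi\to W(\phi\land\psi)$; MP from $\phi,\phi\to\psi$ infer $\psi$; R1 from $\phi\to\psi$ infer $W\phi\land\neg\psi\to W\psi$. $\mathbf{K5^W}$ is $\mathbf{K^W}$ extended with the axiom schema A5: $W\psi\land\neg W(\phi\land\psi)\to W\big((W\chi\to\neg W(\phi\land\chi))\land\psi\big)$ for all $\phi,\psi,\chi$. -}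

module Defs where

open import Data.Bool using (Bool; true; false; not; _∧_)
open import Relation.Binary.PropositionalEquality using (_≡_)

data Form (P : Set) : Set where
  var  : P → Form P
  ¬'_  : Form P → Form P
  _∧'_ : Form P → Form P → Form P
  W    : Form P → Form P

infixr 6 _∧'_
infix 7 ¬'_

module _ {P : Set} where

  infixr 4 _→'_
  infixr 5 _∨'_

  _∨'_ : Form P → Form P → Form P
  φ ∨' ψ = ¬' (¬' φ ∧' ¬' ψ)

  _→'_ : Form P → Form P → Form P
  φ →' ψ = ¬' (φ ∧' ¬' ψ)

  -- Propositional evaluation, treating each formula W φ as an atom:
  -- v assigns values to variables, w assigns values to W-formulas (indexed by
  -- their argument).
  eval : (P → Bool) → (Form P → Bool) → Form P → Bool
  eval v w (var p)  = v p
  eval v w (¬' φ)   = not (eval v w φ)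
  eval v w (φ ∧' ψ) = eval v w φ ∧ eval v w ψ
  eval v w (W φ)    = w φ

  -- φ is an instance of a propositional tautology iff it is true under every
  -- assignment to its propositional atoms (variables and W-formulas).
  Tautology : Form P → Set
  Tautology φ = ∀ (v : P → Bool) (w : Form P → Bool) → eval v w φ ≡ true

  data ⊢K5W : Form P → Set where
    A0 : ∀ {φ} → Tautology φ → ⊢K5W φ
    A1 : ∀ φ → ⊢K5W (W φ →' ¬' φ)
    A2 : ∀ φ ψ → ⊢K5W ((W φ ∧' W ψ) →' W (φ ∧' ψ))
    A5 : ∀ φ ψ χ →
         ⊢K5W ((W ψ ∧' ¬' W (φ ∧' ψ)) →' W ((W χ →' ¬' W (φ ∧' χ)) ∧' ψ))
    MP : ∀ {φ ψ} → ⊢K5W φ → ⊢K5W (φ →' ψ) → ⊢K5W ψ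
    R1 : ∀ {φ ψ} → ⊢K5W (φ →' ψ) → ⊢K5W ((W φ ∧' ¬' ψ) →' W ψ)

-- By A1, ψ is provably equivalent to ¬Wψ ∧ ψ, and W respects provable
-- equivalence (R1 together with A1), so Wψ → W(¬Wψ ∧ ψ). Hence the guard
-- Wψ → ¬W(¬Wψ ∧ ψ) occurring in the instance of A5 with (¬Wψ, φ, ψ) is
-- equivalent to ¬Wψ, and that instance becomes
-- Wφ ∧ ¬W(¬Wψ ∧ φ) → W(¬Wψ ∧ φ), which is propositionally Wφ → W(¬Wψ ∧ φ).
module Submission where

open import Defs
open import Data.Bool using (Bool; true; false; not; _∧_)
open import Data.Bool.Properties using (∧-conicalˡ; ∧-conicalʳ)
open import Data.Nat using (ℕ; zero; suc)
open import Relation.Binary.PropositionalEquality using (_≡_; refl)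

infixr 4 _⇒_

_⇒_ : Bool → Bool → Bool
a ⇒ b = not (a ∧ not b)

-- Each A0 step below applies a truth table to the values of the atoms of a
-- scheme: eval of the instance reduces definitionally to that table.
BoolFun : ℕ → Set
BoolFun zero    = Bool
BoolFun (suc n) = Bool → BoolFun n

Valid : (n : ℕ) → BoolFun n → Set
Valid zero    b = b ≡ true
Valid (suc n) f = ∀ b → Valid n (f b)

valid? : (n : ℕ) → BoolFun n → Bool
valid? zero    b = b
valid? (suc n) f = valid? n (f true) ∧ valid? n (f false)

valid?-sound : (n : ℕ) (f : BoolFun n) → valid? n f ≡ true → Valid n f
valid?-sound zero    b h       = h
valid?-sound (suc n) f h true  = valid?-sound n (f true)  (∧-conicalˡ _ _ h)
valid?-sound (suc n) f h false = valid?-sound n (f false) (∧-conicalʳ _ _ h)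

module _ {P : Set} where

  ∧-elimʳ : (φ ψ : Form P) → ⊢K5W (φ ∧' ψ →' ψ)
  ∧-elimʳ φ ψ = A0 λ v w → table (eval v w φ) (eval v w ψ)
    where
    table : Valid 2 (λ a b → a ∧ b ⇒ b)
    table = valid?-sound 2 _ refl

  →-from-∧¬→ : {φ ψ χ : Form P} →
    ⊢K5W (φ ∧' ¬' ψ →' χ) → ⊢K5W (χ →' ψ) → ⊢K5W (φ →' ψ)
  →-from-∧¬→ {φ} {ψ} {χ} h₁ h₂ =
    MP h₂ (MP h₁ (A0 λ v w → table (eval v w φ) (eval v w ψ) (eval v w χ)))
    where
    table : Valid 3 (λ a b c → (a ∧ not b ⇒ c) ⇒ (c ⇒ b) ⇒ a ⇒ b)
    table = valid?-sound 3 _ refl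

  ¬∧⇒→∧ : (φ ψ χ : Form P) → ⊢K5W (¬' φ ∧' χ →' (φ →' ψ) ∧' χ)
  ¬∧⇒→∧ φ ψ χ = A0 λ v w → table (eval v w φ) (eval v w ψ) (eval v w χ)
    where
    table : Valid 3 (λ a b c → not a ∧ c ⇒ (a ⇒ b) ∧ c)
    table = valid?-sound 3 _ refl

  →¬∧⇒¬∧ : {φ ψ : Form P} (χ : Form P) →
    ⊢K5W (φ →' ψ) → ⊢K5W ((φ →' ¬' ψ) ∧' χ →' ¬' φ ∧' χ)
  →¬∧⇒¬∧ {φ} {ψ} χ h =
    MP h (A0 λ v w → table (eval v w φ) (eval v w ψ) (eval v w χ))
    where
    table : Valid 3 (λ a b c → (a ⇒ b) ⇒ (a ⇒ not b) ∧ c ⇒ not a ∧ c)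
    table = valid?-sound 3 _ refl

  W-cong : {φ ψ : Form P} →
    ⊢K5W (φ →' ψ) → ⊢K5W (ψ →' φ) → ⊢K5W (W φ →' W ψ)
  W-cong {φ} {ψ} φ→ψ ψ→φ = MP ψ→φ (MP (A1 φ) (MP (R1 φ→ψ) (A0 λ v w →
      table (w φ) (eval v w φ) (eval v w ψ) (w ψ))))
    where
    table : Valid 4 (λ wa a b wb →
      (wa ∧ not b ⇒ wb) ⇒ (wa ⇒ not a) ⇒ (b ⇒ a) ⇒ wa ⇒ wb)
    table = valid?-sound 4 _ refl

  ⇒¬W∧ : (φ : Form P) → ⊢K5W (φ →' ¬' W φ ∧' φ)
  ⇒¬W∧ φ = MP (A1 φ) (A0 λ v w → table (w φ) (eval v w φ))
    where
    table : Valid 2 (λ wa a → (wa ⇒ not a) ⇒ a ⇒ not wa ∧ a)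
    table = valid?-sound 2 _ refl

  W⇒W¬W∧ : (φ : Form P) → ⊢K5W (W φ →' W (¬' W φ ∧' φ))
  W⇒W¬W∧ φ = W-cong (⇒¬W∧ φ) (∧-elimʳ (¬' W φ) φ)

  W-A5-guard⇒W¬W∧ : (φ ψ : Form P) →
    ⊢K5W (W ((W ψ →' ¬' W (¬' W ψ ∧' ψ)) ∧' φ) →' W (¬' W ψ ∧' φ))
  W-A5-guard⇒W¬W∧ φ ψ =
    W-cong (→¬∧⇒¬∧ φ (W⇒W¬W∧ ψ)) (¬∧⇒→∧ (W ψ) (¬' W (¬' W ψ ∧' ψ)) φ)

mainTheorem17 : {P : Set} → P → (φ ψ : Form P) →
    ⊢K5W (W φ →' W (¬' W ψ ∧' φ))
mainTheorem17 _ φ ψ = →-from-∧¬→ (A5 (¬' W ψ) φ ψ) (W-A5-guard⇒W¬W∧ φ ψ)
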